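{- Let $n$ be even with $n=2k$. Then $\frac{L(x^{q+1})}x$ is a permutation polynomial of $\mathbb F_{q^n}$ with inverse $\frac{x^{ -1}}{L(x^{ -q-1})^q}$, if (i) $k$ is odd and $L(x)=(bx)^{q^{n-1}}+(bx)^{q^{k-1}}$ for $b\in\mathbb F_{q^n}^*$ such that $b^\frac{q^n-1}{q+1}\ne-1$, or (ii) $k$ is even, $q$ is odd, and $L(x)=(bx)^{q^{n-1}}+(bx)^{q^{k-1}}$ for a square element $b\in\mathbb F_{q^n}^*$, or (iii) $n=4$, $q$ is odd, and $L(x)=(ax^q)^{q^2}+(bx)^{q^2}+ax^q+bx$ for square elements $a,b\in\mathbb F_{q^4}^*$ such that $ab^{ -q}\in\mathbb F_{q^2}$ and $\prod_{i=0}^{3}a^{q^i}\ne\prod_{i=0}^{3}b^{q^i}$.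
   Context: $q$ is a prime power and $\mathbb F_{q^n}$ the finite field of order $q^n$. Polynomials are viewed as maps on $\mathbb F_{q^n}$ (so $x^{q^n}=x$), and $\frac1x$ (or $x^{ -1}$) denotes $x^{q^n-2}$, not a fraction. "Inverse" means compositional inverse. -}

module Defs where

open import Level using (_⊔_)
open import Algebra.Bundles using (CommutativeRing; Semiring)
open import Data.Nat using (ℕ; zero; suc; _∸_; _/_) renaming (_+_ to _+ℕ_; _*_ to _*ℕ_; _^_ to _^ℕ_)
open import Data.Nat.Primality using (Prime)
open import Data.Fin using (Fin)
open import Data.Product using (Σ; ∃; ∃₂; _×_)
open import Data.Sum using (_⊎_)
open import Relation.Binary.PropositionalEquality using (_≡_)
open import Relation.Nullary using (¬_)

IsPrimePower : ℕ → Set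
IsPrimePower q = ∃₂ λ p m → Prime p × q ≡ p ^ℕ suc m

Even Odd : ℕ → Set
Even k = ∃ λ j → k ≡ 2 *ℕ j
Odd  k = ∃ λ j → k ≡ 2 *ℕ j +ℕ 1

module _ {c ℓ} (R : CommutativeRing c ℓ) where
  open CommutativeRing R
  open import Algebra.Definitions.RawSemiring (Semiring.rawSemiring semiring) using (_^_)

  IsField : Set (c ⊔ ℓ)
  IsField = (¬ 1# ≈ 0#) × (∀ x → ¬ x ≈ 0# → ∃ λ y → x * y ≈ 1#)

  HasOrder : ℕ → Set (c ⊔ ℓ)
  HasOrder N = Σ (Fin N → Carrier) λ e →
    (∀ i j → e i ≈ e j → i ≡ j) × (∀ x → ∃ λ i → e i ≈ x)

  IsSquare : Carrier → Set (c ⊔ ℓ)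
  IsSquare b = ∃ λ d → b ≈ d * d

  module Poly (q n : ℕ) where
    inv : Carrier → Carrier
    inv x = x ^ (q ^ℕ n ∸ 2)

    fL : (Carrier → Carrier) → Carrier → Carrier
    fL L x = L (x ^ (q +ℕ 1)) * inv x

    gL : (Carrier → Carrier) → Carrier → Carrier
    gL L x = inv x * inv (L (inv x ^ (q +ℕ 1)) ^ q)

    L₁₂ : ℕ → Carrier → Carrier → Carrier
    L₁₂ k b x = (b * x) ^ (q ^ℕ (n ∸ 1)) + (b * x) ^ (q ^ℕ (k ∸ 1))

    L₃ : Carrier → Carrier → Carrier → Carrier
    L₃ a b x = (a * x ^ q) ^ (q ^ℕ 2) + (b * x) ^ (q ^ℕ 2) + a * x ^ q + b * x

    norm4 : Carrier → Carrier
    norm4 a = a * a ^ q * a ^ (q ^ℕ 2) * a ^ (q ^ℕ 3)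

    Case1 : ℕ → (Carrier → Carrier) → Set (c ⊔ ℓ)
    Case1 k L = Odd k × Σ Carrier λ b → (¬ b ≈ 0#)
      × (¬ b ^ ((q ^ℕ n ∸ 1) / suc q) ≈ - 1#)
      × (∀ x → L x ≈ L₁₂ k b x)

    Case2 : ℕ → (Carrier → Carrier) → Set (c ⊔ ℓ)
    Case2 k L = Even k × Odd q × Σ Carrier λ b → (¬ b ≈ 0#) × IsSquare b
      × (∀ x → L x ≈ L₁₂ k b x)

    Case3 : (Carrier → Carrier) → Set (c ⊔ ℓ)
    Case3 L = n ≡ 4 × Odd q × Σ Carrier λ a → Σ Carrier λ b →
      (¬ a ≈ 0#) × (¬ b ≈ 0#) × IsSquare a × IsSquare b
      × ((a * inv (b ^ q)) ^ (q ^ℕ 2) ≈ a * inv (b ^ q))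
      × (¬ norm4 a ≈ norm4 b)
      × (∀ x → L x ≈ L₃ a b x)

    AreInverse : (Carrier → Carrier) → (Carrier → Carrier) → Set (c ⊔ ℓ)
    AreInverse f g = (∀ x → f (g x) ≈ x) × (∀ x → g (f x) ≈ x)

-- g is a right inverse of f, hence an inverse because the field is finite.  With z = 1/x,
-- w = z^{q+1} and s = L(w)^q, the identity f(g(x)) = x reduces to L((1/s)^{q+1} w) s = 1.
-- In cases (i) and (ii), L(y)^q = T(b y) for the trace T(u) = u + u^{q^k} onto 𝔽_{q^k}; since
-- s = T(b w) lies in 𝔽_{q^k}, the scalar (1/s)^{q+1} comes out of T, and it only remains to
-- see s ≠ 0.  If T(u) = 0 for u = b w ≠ 0 then u^{q^k-1} = -1: in case (i) this gives
-- b^{(q^n-1)/(q+1)} = u^{(q^n-1)/(q+1)} = -1; in case (ii) u is a square v², and then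
-- v^{q^n-1} = -1 ≠ 1 because q is odd.
-- In case (iii), L = T ∘ M with M(y) = a y^q + b y and (1/s)^{q+1} lies in 𝔽_q; here
-- T(M(w)) = 0 would force (a b^{-q})^{q+1} = 1 and hence equal norms of a and b.
module Submission where

open import Level using (_⊔_)
open import Algebra.Bundles using (CommutativeRing)
open import Algebra.Definitions using (Congruent₁)
import Algebra.Properties.CommutativeMonoid.Sum
open import Data.Empty using (⊥-elim)
open import Data.Fin as Fin using (Fin; zero; suc; punchOut)
import Data.Fin.Properties as Finₚ
open import Data.Fin.Permutation using (Permutation; permutation; _⟨$⟩ʳ_)
open import Data.Nat as ℕ using (ℕ; zero; suc; _∸_; _≤_; _<_; s≤s; z≤n; _!)
import Data.Nat.Properties as ℕₚ
open import Data.Nat.Combinatorics using (_C_; nCk≡n!/k![n-k]!; k![n∸k]!∣n!; nCn≡1)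
open import Data.Nat.Divisibility using (_∣_; divides; ∣⇒≤; m∣m*n; ∣1⇒≡1)
open import Data.Nat.DivMod using (_/_; m*[n/m]≡n; m*n/n≡m)
open import Data.Nat.Primality using (Prime; euclidsLemma; prime⇒nonTrivial; prime⇒nonZero)
open import Data.Nat.Tactic.RingSolver using (solve-∀)
open import Data.Product using (∃; _,_; proj₁; proj₂)
open import Data.Sum using (_⊎_; inj₁; inj₂)
open import Data.Vec.Functional using (updateAt; removeAt)
open import Data.Vec.Functional.Properties using (updateAt-updates; updateAt-minimal)
open import Function using (_∘_)
open import Relation.Nullary using (¬_; Dec; yes; no)
import Relation.Nullary.Decidable as Dec
open import Relation.Binary.PropositionalEquality as ≡ using (_≡_; refl)
open import Defs

injective⇒surjective : ∀ {m} (h : Fin m → Fin m) → (∀ {i j} → h i ≡ h j → i ≡ j) →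
                       ∀ y → ∃ λ i → h i ≡ y
injective⇒surjective {zero}  h h-injective ()
injective⇒surjective {suc m} h h-injective y with Finₚ.any? (λ i → h i Finₚ.≟ y)
... | yes hit = hit
... | no miss = ⊥-elim (ℕₚ.<-irrefl refl (Finₚ.injective⇒≤ h′-injective))
  where
  y≢h : ∀ i → ¬ y ≡ h i
  y≢h i y≡hi = miss (i , ≡.sym y≡hi)
  h′ : Fin (suc m) → Fin m
  h′ i = punchOut (y≢h i)
  h′-injective : ∀ {i j} → h′ i ≡ h′ j → i ≡ j
  h′-injective eq = h-injective (Finₚ.punchOut-injective (y≢h _) (y≢h _) eq)

module Arithmetic where
  open import Data.Nat using (_+_; _*_; _^_)
  open ≡.≡-Reasoning

  prime⇒2≤ : ∀ {p} → Prime p → 2 ≤ p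
  prime⇒2≤ {p} p-prime = ℕ.nonTrivial⇒n>1 p {{prime⇒nonTrivial p-prime}}

  prime∣n!⇒≤ : ∀ {p} → Prime p → ∀ n → p ∣ n ! → p ≤ n
  prime∣n!⇒≤ p-prime zero p∣1 with ∣1⇒≡1 p∣1 | prime⇒2≤ p-prime
  ... | refl | s≤s ()
  prime∣n!⇒≤ p-prime (suc n) p∣n! with euclidsLemma (suc n) (n !) p-prime p∣n!
  ... | inj₁ p∣1+n = ∣⇒≤ p∣1+n
  ... | inj₂ p∣n!  = ℕₚ.m≤n⇒m≤1+n (prime∣n!⇒≤ p-prime n p∣n!)

  n∣n! : ∀ {n} → 1 ≤ n → n ∣ n !
  n∣n! {suc n} _ = m∣m*n (n !)

  -- p! = k! (p - k)! (p C k), and p divides neither k! nor (p - k)!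
  prime∣pCk : ∀ {p k} → Prime p → 1 ≤ k → k < p → p ∣ p C k
  prime∣pCk {p} {k} p-prime 1≤k k<p
    with euclidsLemma (k ! * (p ∸ k) !) (p C k) p-prime p∣product
    where
    instance _ = k ℕₚ.!* (p ∸ k) !≢0
    k≤p = ℕₚ.<⇒≤ k<p
    product≡p! : k ! * (p ∸ k) ! * (p C k) ≡ p !
    product≡p! = ≡.trans (≡.cong (k ! * (p ∸ k) ! *_) (nCk≡n!/k![n-k]! k≤p)) (m*[n/m]≡n (k![n∸k]!∣n! k≤p))
    p∣product : p ∣ k ! * (p ∸ k) ! * (p C k)
    p∣product = ≡.subst (p ∣_) (≡.sym product≡p!) (n∣n! (ℕₚ.<-trans (s≤s z≤n) (prime⇒2≤ p-prime)))
  ... | inj₂ p∣pCk = p∣pCk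
  ... | inj₁ p∣k![p-k]! with euclidsLemma (k !) ((p ∸ k) !) p-prime p∣k![p-k]!
  ...   | inj₁ p∣k! = ⊥-elim (ℕₚ.<⇒≱ k<p (prime∣n!⇒≤ p-prime k p∣k!))
  ...   | inj₂ p∣[p-k]! =
    ⊥-elim (ℕₚ.<⇒≱ (ℕₚ.∸-monoʳ-< {p} {k} {0} 1≤k (ℕₚ.<⇒≤ k<p)) (prime∣n!⇒≤ p-prime (p ∸ k) p∣[p-k]!))

  2≤p^[1+m] : ∀ {p} → Prime p → ∀ m → 2 ≤ p ^ suc m
  2≤p^[1+m] {p} p-prime m = ℕₚ.*-mono-≤ (prime⇒2≤ p-prime) (ℕₚ.m^n>0 p m)
    where instance _ = prime⇒nonZero p-prime

  4≤b^[2+m] : ∀ {b} → 2 ≤ b → ∀ m → 4 ≤ b ^ (2 + m)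
  4≤b^[2+m] {b} 2≤b m = ℕₚ.≤-trans (ℕₚ.^-monoʳ-≤ 2 (ℕₚ.m≤m+n 2 m)) (ℕₚ.^-monoˡ-≤ (2 + m) 2≤b)

  -- With q = 1 + r, the cofactor (q^{2j+1} + 1)/(q + 1) = 1 - q + q² - … + q^{2j} is ≡ 1 (mod q - 1).
  [1+q]∣[1+q^[2j+1]] : ∀ r j → ∃ λ S → suc (suc r) * suc (r * S) ≡ suc (suc r ^ (2 * j + 1))
  [1+q]∣[1+q^[2j+1]] r zero = 0 , base r
    where
    base : ∀ r → suc (suc r) * suc (r * 0) ≡ suc (suc r * 1)
    base = solve-∀
  [1+q]∣[1+q^[2j+1]] r (suc j) with S , eq ← [1+q]∣[1+q^[2j+1]] r j = S + O , (begin
    suc (suc r) * suc (r * (S + O))           ≡⟨ expand r S O ⟩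
    suc (suc r) * suc (r * S) + suc (suc r) * r * O ≡⟨ ≡.cong (_+ suc (suc r) * r * O) eq ⟩
    suc O + suc (suc r) * r * O               ≡⟨ collect r O ⟩
    suc (suc r * (suc r * O))                 ≡⟨ ≡.cong (λ e → suc (suc r ^ e)) (exponent j) ⟩
    suc (suc r ^ (2 * suc j + 1))             ∎)
    where
    O = suc r ^ (2 * j + 1)
    exponent : ∀ j → suc (suc (2 * j + 1)) ≡ 2 * suc j + 1
    exponent = solve-∀
    expand : ∀ r S O → suc (suc r) * suc (r * (S + O)) ≡ suc (suc r) * suc (r * S) + suc (suc r) * r * O
    expand = solve-∀
    collect : ∀ r O → suc O + suc (suc r) * r * O ≡ suc (suc r * (suc r * O))
    collect = solve-∀

  [x∸1]*[1+x]≡x*x∸1 : ∀ {x} → 1 ≤ x → (x ∸ 1) * suc x ≡ x * x ∸ 1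
  [x∸1]*[1+x]≡x*x∸1 {suc t} _ = lemma t
    where
    lemma : ∀ t → t * suc (suc t) ≡ t + t * suc t
    lemma = solve-∀

  [1+q]∣q^[k+k]∸1 : ∀ q j → 1 ≤ q → ∃ λ S →
    suc q * ((q ^ (2 * j + 1) ∸ 1) * suc ((q ∸ 1) * S)) ≡ q ^ ((2 * j + 1) + (2 * j + 1)) ∸ 1
  [1+q]∣q^[k+k]∸1 q@(suc r) j _ with S , eq ← [1+q]∣[1+q^[2j+1]] r j = S , (begin
    suc q * ((x ∸ 1) * E)   ≡⟨ leftComm (suc q) (x ∸ 1) E ⟩
    (x ∸ 1) * (suc q * E)   ≡⟨ ≡.cong ((x ∸ 1) *_) eq ⟩
    (x ∸ 1) * suc x         ≡⟨ [x∸1]*[1+x]≡x*x∸1 (ℕₚ.m^n>0 q k) ⟩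
    x * x ∸ 1               ≡⟨ ≡.cong (_∸ 1) (ℕₚ.^-distribˡ-+-* q k k) ⟨
    q ^ (k + k) ∸ 1         ∎)
    where
    k = 2 * j + 1
    x = q ^ k
    E = suc (r * S)
    leftComm : ∀ a b c → a * (b * c) ≡ b * (a * c)
    leftComm = solve-∀

  odd^even≡1+4c : ∀ a j → ∃ λ c → (2 * a + 1) ^ (2 * j) ≡ suc (4 * c)
  odd^even≡1+4c a zero = 0 , refl
  odd^even≡1+4c a (suc j) with c , eq ← odd^even≡1+4c a j = (a * a + a) * suc (4 * c) + c , (begin
    q ^ (2 * suc j)           ≡⟨ ≡.cong (q ^_) (exponent j) ⟩
    q * (q * q ^ (2 * j))     ≡⟨ ≡.cong (λ x → q * (q * x)) eq ⟩
    q * (q * suc (4 * c))     ≡⟨ square a c ⟩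
    suc (4 * ((a * a + a) * suc (4 * c) + c)) ∎)
    where
    q = 2 * a + 1
    exponent : ∀ j → 2 * suc j ≡ suc (suc (2 * j))
    exponent = solve-∀
    square : ∀ a c → (2 * a + 1) * ((2 * a + 1) * suc (4 * c)) ≡ suc (4 * ((a * a + a) * suc (4 * c) + c))
    square = solve-∀

  -- q^k ≡ 1 (mod 4) makes the cofactor (q^k + 1)/2 odd.
  q^[k+k]∸1≡2[q^k∸1][1+2c] : ∀ a j → ∃ λ c →
    (2 * a + 1) ^ (2 * j + 2 * j) ∸ 1 ≡ 2 * (((2 * a + 1) ^ (2 * j) ∸ 1) * suc (2 * c))
  q^[k+k]∸1≡2[q^k∸1][1+2c] a j with c , eq ← odd^even≡1+4c a j = c , (begin
    q ^ (k + k) ∸ 1                   ≡⟨ ≡.cong (_∸ 1) (ℕₚ.^-distribˡ-+-* q k k) ⟩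
    q ^ k * q ^ k ∸ 1                 ≡⟨ ≡.cong (λ x → x * x ∸ 1) eq ⟩
    suc (4 * c) * suc (4 * c) ∸ 1     ≡⟨ [x∸1]*[1+x]≡x*x∸1 {suc (4 * c)} (s≤s z≤n) ⟨
    4 * c * suc (suc (4 * c))         ≡⟨ halve c ⟩
    2 * (4 * c * suc (2 * c))         ≡⟨ ≡.cong (λ x → 2 * ((x ∸ 1) * suc (2 * c))) eq ⟨
    2 * ((q ^ k ∸ 1) * suc (2 * c))   ∎)
    where
    q = 2 * a + 1
    k = 2 * j
    halve : ∀ c → 4 * c * suc (suc (4 * c)) ≡ 2 * (4 * c * suc (2 * c))
    halve = solve-∀

  *≡⇒/≡ : ∀ {a b c} → suc a * b ≡ c → c / suc a ≡ b
  *≡⇒/≡ {a} {b} refl = ≡.trans (≡.cong (_/ suc a) (ℕₚ.*-comm (suc a) b)) (m*n/n≡m b (suc a))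

open Arithmetic

module PowerLaws {ℓ₁ ℓ₂} (R : CommutativeRing ℓ₁ ℓ₂) where
  open CommutativeRing R hiding (zero; refl)
  open import Algebra.Properties.Semiring.Exp semiring
  open import Algebra.Properties.Semiring.Mult semiring
  open import Algebra.Properties.Ring ring using (-1*x≈-x)
  open import Algebra.Properties.Group +-group using (inverseʳ-unique; ⁻¹-involutive)
  open import Relation.Binary.Reasoning.Setoid setoid
  module Σ = Algebra.Properties.CommutativeMonoid.Sum +-commutativeMonoid
  import Algebra.Properties.CommutativeSemiring.Binomial commutativeSemiring as Binomial

  IsAdditive : ℕ → Set (ℓ₁ ⊔ ℓ₂)
  IsAdditive e = ∀ x y → (x + y) ^ e ≈ x ^ e + y ^ e

  additive-1 : IsAdditive 1
  additive-1 x y = trans (*-identityʳ _) (sym (+-cong (*-identityʳ x) (*-identityʳ y)))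

  additive-* : ∀ {a b} → IsAdditive a → IsAdditive b → IsAdditive (a ℕ.* b)
  additive-* {a} {b} additive-a additive-b x y = begin
    (x + y) ^ (a ℕ.* b)           ≈⟨ ^-assocʳ (x + y) a b ⟨
    ((x + y) ^ a) ^ b             ≈⟨ ^-congˡ b (additive-a x y) ⟩
    (x ^ a + y ^ a) ^ b           ≈⟨ additive-b _ _ ⟩
    (x ^ a) ^ b + (y ^ a) ^ b     ≈⟨ +-cong (^-assocʳ x a b) (^-assocʳ y a b) ⟩
    x ^ (a ℕ.* b) + y ^ (a ℕ.* b) ∎

  additive-^ : ∀ {a} → IsAdditive a → ∀ t → IsAdditive (a ℕ.^ t)
  additive-^ additive-a zero    = additive-1
  additive-^ {a} additive-a (suc t) = additive-* {a} {a ℕ.^ t} additive-a (additive-^ additive-a t)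

  additive⇒-‿^ : ∀ {e} → IsAdditive (suc e) → ∀ x → (- x) ^ suc e ≈ - (x ^ suc e)
  additive⇒-‿^ {e} additive x = inverseʳ-unique (x ^ suc e) ((- x) ^ suc e) (begin
    x ^ suc e + (- x) ^ suc e  ≈⟨ additive x (- x) ⟨
    (x + - x) ^ suc e          ≈⟨ ^-congˡ (suc e) (-‿inverseʳ x) ⟩
    0# ^ suc e                 ≈⟨ zeroˡ _ ⟩
    0#                         ∎)

  ×≈×1* : ∀ m x → m × x ≈ (m × 1#) * x
  ×≈×1* m x = sym (trans (×-assoc-* m 1# x) (×-congʳ m (*-identityˡ x)))

  ∣⇒×≈0 : ∀ {p m} → p × 1# ≈ 0# → p ∣ m → ∀ x → m × x ≈ 0#
  ∣⇒×≈0 {p} p×1≈0 (divides d refl) x = begin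
    (d ℕ.* p) × x                  ≈⟨ ×≈×1* (d ℕ.* p) x ⟩
    ((d ℕ.* p) × 1#) * x           ≈⟨ *-congʳ (×1-homo-* d p) ⟩
    ((d × 1#) * (p × 1#)) * x      ≈⟨ *-congʳ (*-congˡ p×1≈0) ⟩
    ((d × 1#) * 0#) * x            ≈⟨ *-congʳ (zeroʳ _) ⟩
    0# * x                         ≈⟨ zeroˡ x ⟩
    0#                             ∎

  -- In (x + y)^p only the two outer binomial terms survive, since p divides the inner coefficients.
  prime-char⇒additive : ∀ {p} → Prime p → p × 1# ≈ 0# → IsAdditive p
  prime-char⇒additive {p} p-prime p×1≈0 x y = additive p refl (prime⇒2≤ p-prime)
    where
    additive : ∀ p′ → p′ ≡ p → 2 ≤ p′ → (x + y) ^ p′ ≈ x ^ p′ + y ^ p′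
    additive (suc r) refl _ = begin
      (x + y) ^ suc r                                            ≈⟨ Binomial.theorem (suc r) x y ⟩
      T zero + Σ.sum {suc r} (T ∘ suc)                           ≈⟨ +-congˡ (Σ.sum-init-last (T ∘ suc)) ⟩
      T zero + (Σ.sum {r} (T ∘ suc ∘ Fin.inject₁) + T (suc (Fin.fromℕ r)))
        ≈⟨ +-congˡ (+-congʳ (trans (Σ.sum-cong-≋ inner≈0) (Σ.sum-replicate-zero r))) ⟩
      T zero + (0# + T (suc (Fin.fromℕ r)))                      ≈⟨ +-cong first (trans (+-identityˡ _) last) ⟩
      y ^ suc r + x ^ suc r                                      ≈⟨ +-comm _ _ ⟩
      x ^ suc r + y ^ suc r                                      ∎
      where
      T = Binomial.binomialTerm x y (suc r)
      first : T zero ≈ y ^ suc r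
      first = trans (+-identityʳ _) (*-identityˡ _)
      last : T (suc (Fin.fromℕ r)) ≈ x ^ suc r
      last rewrite Finₚ.toℕ-fromℕ r | nCn≡1 (suc r) | ℕₚ.n∸n≡0 r = trans (+-identityʳ _) (*-identityʳ _)
      inner≈0 : ∀ i → T (suc (Fin.inject₁ i)) ≈ 0#
      inner≈0 i rewrite Finₚ.toℕ-inject₁ i =
        ∣⇒×≈0 p×1≈0 (prime∣pCk p-prime (s≤s z≤n) (s≤s (Finₚ.toℕ<n i))) _

  1^n≈1 : ∀ n → 1# ^ n ≈ 1#
  1^n≈1 zero    = reflexive refl
  1^n≈1 (suc n) = trans (*-identityˡ _) (1^n≈1 n)

  -1*-1≈1 : - 1# * - 1# ≈ 1#
  -1*-1≈1 = trans (-1*x≈-x (- 1#)) (⁻¹-involutive 1#)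

  -1^[1+e]≈-1⇒-1^[1+e*s]≈-1 : ∀ {e} → (- 1#) ^ suc e ≈ - 1# → ∀ s → (- 1#) ^ suc (e ℕ.* s) ≈ - 1#
  -1^[1+e]≈-1⇒-1^[1+e*s]≈-1 {e} -1^[1+e]≈-1 s = begin
    - 1# * (- 1#) ^ (e ℕ.* s)      ≈⟨ *-congˡ (^-assocʳ (- 1#) e s) ⟨
    - 1# * ((- 1#) ^ e) ^ s        ≈⟨ *-congˡ (^-congˡ s -1^e≈1) ⟩
    - 1# * 1# ^ s                  ≈⟨ *-congˡ (1^n≈1 s) ⟩
    - 1# * 1#                      ≈⟨ *-identityʳ _ ⟩
    - 1#                           ∎
    where
    -1^e≈1 : (- 1#) ^ e ≈ 1#
    -1^e≈1 = begin
      (- 1#) ^ e                   ≈⟨ *-identityˡ _ ⟨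
      1# * (- 1#) ^ e              ≈⟨ *-congʳ -1*-1≈1 ⟨
      (- 1# * - 1#) * (- 1#) ^ e   ≈⟨ *-assoc _ _ _ ⟩
      - 1# * (- 1#) ^ suc e        ≈⟨ *-congˡ -1^[1+e]≈-1 ⟩
      - 1# * - 1#                  ≈⟨ -1*-1≈1 ⟩
      1#                           ∎

  ^-comm : ∀ x a b → (x ^ a) ^ b ≈ (x ^ b) ^ a
  ^-comm x a b = trans (^-assocʳ x a b) (trans (^-congʳ x (ℕₚ.*-comm a b)) (sym (^-assocʳ x b a)))

  ^×1≈×1^ : ∀ p N → (p ℕ.^ N) × 1# ≈ (p × 1#) ^ N
  ^×1≈×1^ p zero    = +-identityʳ 1#
  ^×1≈×1^ p (suc N) = trans (×1-homo-* p (p ℕ.^ N)) (*-congˡ (^×1≈×1^ p N))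

module FieldProperties {ℓ₁ ℓ₂} (R : CommutativeRing ℓ₁ ℓ₂) (isField : IsField R) where
  open CommutativeRing R hiding (zero; refl)
  open import Algebra.Properties.Semiring.Exp semiring using (_^_)
  open import Relation.Binary.Reasoning.Setoid setoid

  1≉0 : ¬ 1# ≈ 0#
  1≉0 = proj₁ isField

  *-cancelʳ : ∀ {a b x} → ¬ x ≈ 0# → a * x ≈ b * x → a ≈ b
  *-cancelʳ {a} {b} {x} x≉0 ax≈bx with y , xy≈1 ← proj₂ isField x x≉0 = begin
    a            ≈⟨ *-identityʳ a ⟨
    a * 1#       ≈⟨ *-congˡ xy≈1 ⟨
    a * (x * y)  ≈⟨ *-assoc a x y ⟨
    (a * x) * y  ≈⟨ *-congʳ ax≈bx ⟩
    (b * x) * y  ≈⟨ *-assoc b x y ⟩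
    b * (x * y)  ≈⟨ *-congˡ xy≈1 ⟩
    b * 1#       ≈⟨ *-identityʳ b ⟩
    b            ∎

  *-cancelˡ : ∀ {a b x} → ¬ x ≈ 0# → x * a ≈ x * b → a ≈ b
  *-cancelˡ {a} {b} {x} x≉0 xa≈xb = *-cancelʳ x≉0 (trans (*-comm a x) (trans xa≈xb (*-comm x b)))

  *-nonzero : ∀ {x y} → ¬ x ≈ 0# → ¬ y ≈ 0# → ¬ x * y ≈ 0#
  *-nonzero {x} x≉0 y≉0 xy≈0 = y≉0 (*-cancelˡ x≉0 (trans xy≈0 (sym (zeroʳ x))))

  ^-nonzero : ∀ {x} m → ¬ x ≈ 0# → ¬ x ^ m ≈ 0#
  ^-nonzero zero    x≉0 = 1≉0
  ^-nonzero (suc m) x≉0 = *-nonzero x≉0 (^-nonzero m x≉0)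

module FiniteField {ℓ₁ ℓ₂} (R : CommutativeRing ℓ₁ ℓ₂) (isField : IsField R) (Q : ℕ) (order : HasOrder R Q) where
  open CommutativeRing R hiding (zero; refl)
  open FieldProperties R isField
  open import Algebra.Properties.Semiring.Exp semiring
  open import Algebra.Properties.Semiring.Mult semiring
  open import Algebra.Properties.CommutativeSemiring.Exp commutativeSemiring using (^-distrib-*)
  open import Algebra.Properties.Group +-group using (identityˡ-unique)
  open import Relation.Binary.Reasoning.Setoid setoid
  module Σ = Algebra.Properties.CommutativeMonoid.Sum +-commutativeMonoid
  module Π = Algebra.Properties.CommutativeMonoid.Sum *-commutativeMonoid

  private
    enum : Fin Q → Carrier
    enum = proj₁ order

    enum-injective : ∀ i j → enum i ≈ enum j → i ≡ j
    enum-injective = proj₁ (proj₂ order)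

    index : Carrier → Fin Q
    index x = proj₁ (proj₂ (proj₂ order) x)

    enum∘index : ∀ x → enum (index x) ≈ x
    enum∘index x = proj₂ (proj₂ (proj₂ order) x)

    index-injective : ∀ {x y} → index x ≡ index y → x ≈ y
    index-injective {x} {y} eq = trans (sym (enum∘index x)) (trans (reflexive (≡.cong enum eq)) (enum∘index y))

    index-cong : ∀ {x y} → x ≈ y → index x ≡ index y
    index-cong {x} {y} x≈y = enum-injective _ _ (trans (enum∘index x) (trans x≈y (sym (enum∘index y))))

  _≟_ : ∀ x y → Dec (x ≈ y)
  x ≟ y = Dec.map′ index-injective index-cong (index x Finₚ.≟ index y)

  2≤Q : 2 ≤ Q
  2≤Q = distinct⇒2≤ (index 1#) (index 0#) (1≉0 ∘ index-injective)
    where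
    distinct⇒2≤ : ∀ {m} (i j : Fin m) → ¬ i ≡ j → 2 ≤ m
    distinct⇒2≤ {suc zero}    zero zero i≢j = ⊥-elim (i≢j refl)
    distinct⇒2≤ {suc (suc _)} _    _    _   = s≤s (s≤s z≤n)

  private
    toPermutation : (f g : Carrier → Carrier) → Congruent₁ _≈_ f → Congruent₁ _≈_ g →
                    (∀ x → f (g x) ≈ x) → (∀ x → g (f x) ≈ x) → Permutation Q Q
    toPermutation f g f-cong g-cong f∘g g∘f = permutation
      (λ i → index (f (enum i))) (λ i → index (g (enum i)))
      (λ i → enum-injective _ _ (trans (enum∘index _) (trans (f-cong (enum∘index _)) (f∘g (enum i)))))
      (λ i → enum-injective _ _ (trans (enum∘index _) (trans (g-cong (enum∘index _)) (g∘f (enum i)))))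

  -- Translation by x permutes the field, so ∑ e = ∑ (x + e) = Q × x + ∑ e.
  Q×x≈0 : ∀ x → Q × x ≈ 0#
  Q×x≈0 x = identityˡ-unique (Q × x) (Σ.sum enum) (begin
    Q × x + Σ.sum enum                ≈⟨ +-congʳ (Σ.sum-replicate Q) ⟨
    Σ.sum {Q} (λ _ → x) + Σ.sum enum  ≈⟨ Σ.∑-distrib-+ (λ _ → x) enum ⟨
    Σ.sum (λ i → x + enum i)          ≈⟨ Σ.sum-cong-≋ (λ i → sym (enum∘index (x + enum i))) ⟩
    Σ.sum (λ i → enum (π ⟨$⟩ʳ i))     ≈⟨ Σ.∑-permute enum π ⟨
    Σ.sum enum                        ∎)
    where
    π = toPermutation (x +_) (- x +_) +-congˡ +-congˡ
      (λ y → trans (sym (+-assoc _ _ _)) (trans (+-congʳ (-‿inverseʳ x)) (+-identityˡ y)))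
      (λ y → trans (sym (+-assoc _ _ _)) (trans (+-congʳ (-‿inverseˡ x)) (+-identityˡ y)))

  -- Multiplication by x ≉ 0 permutes the field; compare the products over all elements,
  -- with 0 replaced by 1 so that the product can be cancelled.
  x^[Q∸1]≈1 : ∀ {x} → ¬ x ≈ 0# → x ^ (Q ∸ 1) ≈ 1#
  x^[Q∸1]≈1 {x} x≉0 = fermat (Q ∸ 1) (≡.sym (ℕₚ.m+[n∸m]≡n (ℕₚ.<-trans (s≤s z≤n) 2≤Q)))
    where
    y = proj₁ (proj₂ isField x x≉0)
    xy≈1 = proj₂ (proj₂ isField x x≉0)
    π = toPermutation (x *_) (y *_) *-congˡ *-congˡ
      (λ z → trans (sym (*-assoc _ _ _)) (trans (*-congʳ xy≈1) (*-identityˡ z)))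
      (λ z → trans (sym (*-assoc _ _ _)) (trans (*-congʳ (trans (*-comm y x) xy≈1)) (*-identityˡ z)))
    o = index 0#
    G H : Fin Q → Carrier
    G = updateAt enum o (λ _ → 1#)
    H = updateAt (λ _ → x) o (λ _ → 1#)

    enum≉0 : ∀ {i} → ¬ i ≡ o → ¬ enum i ≈ 0#
    enum≉0 i≢o ei≈0 = i≢o (enum-injective _ _ (trans ei≈0 (sym (enum∘index 0#))))

    G≉0 : ∀ i → ¬ G i ≈ 0#
    G≉0 i with i Finₚ.≟ o
    ... | yes refl = λ G≈0 → 1≉0 (trans (reflexive (≡.sym (updateAt-updates o enum))) G≈0)
    ... | no i≢o   = λ G≈0 → enum≉0 i≢o (trans (reflexive (≡.sym (updateAt-minimal i o enum i≢o))) G≈0)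

    π-fixes-o : π ⟨$⟩ʳ o ≡ o
    π-fixes-o = index-cong (trans (*-congˡ (enum∘index 0#)) (zeroʳ x))

    G∘π≈H*G : ∀ i → G (π ⟨$⟩ʳ i) ≈ H i * G i
    G∘π≈H*G i with i Finₚ.≟ o
    ... | yes refl = begin
      G (π ⟨$⟩ʳ o)   ≡⟨ ≡.cong G π-fixes-o ⟩
      G o            ≡⟨ updateAt-updates o enum ⟩
      1#             ≈⟨ *-identityˡ 1# ⟨
      1# * 1#        ≡⟨ ≡.cong₂ _*_ (updateAt-updates o (λ _ → x)) (updateAt-updates o enum) ⟨
      H o * G o      ∎
    ... | no i≢o = begin
      G (π ⟨$⟩ʳ i)      ≡⟨ updateAt-minimal (π ⟨$⟩ʳ i) o enum πi≢o ⟩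
      enum (π ⟨$⟩ʳ i)   ≈⟨ enum∘index (x * enum i) ⟩
      x * enum i        ≡⟨ ≡.cong₂ _*_ (updateAt-minimal i o (λ _ → x) i≢o) (updateAt-minimal i o enum i≢o) ⟨
      H i * G i         ∎
      where
      πi≢o : ¬ π ⟨$⟩ʳ i ≡ o
      πi≢o πi≡o = *-nonzero x≉0 (enum≉0 i≢o)
        (trans (sym (enum∘index _)) (trans (reflexive (≡.cong enum πi≡o)) (enum∘index 0#)))

    ∏-nonzero : ∀ {m} (f : Fin m → Carrier) → (∀ i → ¬ f i ≈ 0#) → ¬ Π.sum f ≈ 0#
    ∏-nonzero {zero}  f f≉0 = 1≉0
    ∏-nonzero {suc m} f f≉0 = *-nonzero (f≉0 zero) (∏-nonzero (f ∘ suc) (f≉0 ∘ suc))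

    fermat : ∀ m → Q ≡ suc m → x ^ m ≈ 1#
    fermat m refl = *-cancelʳ (∏-nonzero G G≉0) (begin
      x ^ m * Π.sum G                 ≈⟨ *-congʳ ∏H≈x^m ⟨
      Π.sum H * Π.sum G               ≈⟨ Π.∑-distrib-+ H G ⟨
      Π.sum (λ i → H i * G i)         ≈⟨ Π.sum-cong-≋ G∘π≈H*G ⟨
      Π.sum (λ i → G (π ⟨$⟩ʳ i))      ≈⟨ Π.∑-permute G π ⟨
      Π.sum G                         ≈⟨ *-identityˡ _ ⟨
      1# * Π.sum G                    ∎)
      where
      ∏H≈x^m : Π.sum H ≈ x ^ m
      ∏H≈x^m = begin
        Π.sum H                        ≈⟨ Π.sum-remove {i = o} H ⟩
        H o * Π.sum (removeAt H o)     ≈⟨ *-cong (reflexive (updateAt-updates o (λ _ → x)))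
                                            (Π.sum-cong-≋ λ i →
                                              reflexive (updateAt-minimal _ o _ (Finₚ.punchInᵢ≢i o i))) ⟩
        1# * Π.sum {m} (λ _ → x)       ≈⟨ *-identityˡ _ ⟩
        Π.sum {m} (λ _ → x)            ≈⟨ Π.sum-replicate m ⟩
        x ^ m                          ∎

  private
    Q≡1+[Q∸1] : Q ≡ suc (Q ∸ 1)
    Q≡1+[Q∸1] = ≡.sym (ℕₚ.m+[n∸m]≡n (ℕₚ.<-trans (s≤s z≤n) 2≤Q))

  x^Q≈x : ∀ x → x ^ Q ≈ x
  x^Q≈x x with x ≟ 0#
  ... | yes x≈0 = begin
    x ^ Q                ≡⟨ ≡.cong (x ^_) Q≡1+[Q∸1] ⟩
    x * x ^ (Q ∸ 1)      ≈⟨ *-congʳ x≈0 ⟩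
    0# * x ^ (Q ∸ 1)     ≈⟨ zeroˡ _ ⟩
    0#                   ≈⟨ x≈0 ⟨
    x                    ∎
  ... | no x≉0 = begin
    x ^ Q                ≡⟨ ≡.cong (x ^_) Q≡1+[Q∸1] ⟩
    x * x ^ (Q ∸ 1)      ≈⟨ *-congˡ (x^[Q∸1]≈1 x≉0) ⟩
    x * 1#               ≈⟨ *-identityʳ x ⟩
    x                    ∎

  rightInverse⇒leftInverse : ∀ (f g : Carrier → Carrier) → Congruent₁ _≈_ f → Congruent₁ _≈_ g →
                             (∀ x → f (g x) ≈ x) → ∀ x → g (f x) ≈ x
  rightInverse⇒leftInverse f g f-cong g-cong f∘g x = begin
      g (f x)              ≈⟨ g-cong (f-cong x≈g[ei]) ⟩
      g (f (g (enum i)))   ≈⟨ g-cong (f∘g (enum i)) ⟩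
      g (enum i)           ≈⟨ x≈g[ei] ⟨
      x                    ∎
    where
    h : Fin Q → Fin Q
    h i = index (g (enum i))
    h-injective : ∀ {i j} → h i ≡ h j → i ≡ j
    h-injective {i} {j} hi≡hj = enum-injective _ _ (begin
      enum i               ≈⟨ f∘g (enum i) ⟨
      f (g (enum i))       ≈⟨ f-cong (index-injective hi≡hj) ⟩
      f (g (enum j))       ≈⟨ f∘g (enum j) ⟩
      enum j               ∎)
    preimage = injective⇒surjective h h-injective (index x)
    i = proj₁ preimage
    x≈g[ei] : x ≈ g (enum i)
    x≈g[ei] = sym (index-injective (proj₂ preimage))

  open PowerLaws R using (^-comm)

  -- Definitionally the same as Poly.inv when Q = q ^ n.
  _⁻¹ : Carrier → Carrier
  x ⁻¹ = x ^ (Q ∸ 2)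

  x*x⁻¹≈1 : ∀ {x} → ¬ x ≈ 0# → x * x ⁻¹ ≈ 1#
  x*x⁻¹≈1 {x} x≉0 = trans (^-congʳ x (≡.sym (ℕₚ.+-∸-assoc 1 2≤Q))) (x^[Q∸1]≈1 x≉0)

  x⁻¹*x≈1 : ∀ {x} → ¬ x ≈ 0# → x ⁻¹ * x ≈ 1#
  x⁻¹*x≈1 {x} x≉0 = trans (*-comm _ x) (x*x⁻¹≈1 x≉0)

  ⁻¹-cong : Congruent₁ _≈_ _⁻¹
  ⁻¹-cong = ^-congˡ (Q ∸ 2)

  ⁻¹-nonzero : ∀ {x} → ¬ x ≈ 0# → ¬ x ⁻¹ ≈ 0#
  ⁻¹-nonzero {x} x≉0 x⁻¹≈0 = 1≉0 (trans (sym (x*x⁻¹≈1 x≉0)) (trans (*-congˡ x⁻¹≈0) (zeroʳ x)))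

  ⁻¹-distrib-* : ∀ x y → (x * y) ⁻¹ ≈ x ⁻¹ * y ⁻¹
  ⁻¹-distrib-* x y = ^-distrib-* x y (Q ∸ 2)

  ⁻¹-^ : ∀ x a → (x ^ a) ⁻¹ ≈ (x ⁻¹) ^ a
  ⁻¹-^ x a = ^-comm x a (Q ∸ 2)

  -- For Q = 2 the convention gives 0⁻¹ = 0⁰ = 1.
  0⁻¹≈0 : 3 ≤ Q → 0# ⁻¹ ≈ 0#
  0⁻¹≈0 3≤Q = trans (^-congʳ 0# (ℕₚ.+-∸-assoc 1 3≤Q)) (zeroˡ _)

  ⁻¹-involutive : 3 ≤ Q → ∀ x → x ⁻¹ ⁻¹ ≈ x
  ⁻¹-involutive 3≤Q x with x ≟ 0#
  ... | yes x≈0 = trans (⁻¹-cong (trans (⁻¹-cong x≈0) (0⁻¹≈0 3≤Q))) (trans (0⁻¹≈0 3≤Q) (sym x≈0))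
  ... | no x≉0  = *-cancelʳ (⁻¹-nonzero x≉0) (trans (x⁻¹*x≈1 (⁻¹-nonzero x≉0)) (sym (x*x⁻¹≈1 x≉0)))

module PrimePowerField {ℓ₁ ℓ₂} (R : CommutativeRing ℓ₁ ℓ₂) (isField : IsField R) {q n : ℕ}
                       (q-pp : IsPrimePower q) (order : HasOrder R (q ℕ.^ n)) (2≤n : 2 ≤ n) where
  open CommutativeRing R hiding (zero) renaming (refl to ≈-refl)
  open FieldProperties R isField
  open FiniteField R isField (q ℕ.^ n) order
  open PowerLaws R
  open import Algebra.Properties.Semiring.Exp semiring
  open import Algebra.Properties.Semiring.Mult semiring
  open import Algebra.Properties.CommutativeSemiring.Exp commutativeSemiring using (^-distrib-*)
  open import Relation.Binary.Reasoning.Setoid setoid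
  open import Algebra.Properties.CommutativeSemigroup *-commutativeSemigroup using (x∙yz≈y∙xz; xy∙z≈xz∙y; interchange)
  open import Algebra.Solver.Ring.NaturalCoefficients.Default commutativeSemiring using (solve; _:+_; _:*_; _:=_)
  open import Algebra.Properties.Ring ring using (-1*x≈-x)
  open import Algebra.Properties.Group +-group using (inverseʳ-unique)

  private
    p = proj₁ q-pp
    m = proj₁ (proj₂ q-pp)
    p-prime : Prime p
    p-prime = proj₁ (proj₂ (proj₂ q-pp))
    q≡p^[1+m] : q ≡ p ℕ.^ suc m
    q≡p^[1+m] = proj₂ (proj₂ (proj₂ q-pp))

  2≤q : 2 ≤ q
  2≤q = ≡.subst (2 ≤_) (≡.sym q≡p^[1+m]) (2≤p^[1+m] p-prime m)

  3≤Q : 3 ≤ q ℕ.^ n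
  3≤Q = ℕₚ.≤-trans (s≤s (s≤s (s≤s z≤n)))
    (≡.subst (λ e → 4 ≤ q ℕ.^ e) (ℕₚ.m+[n∸m]≡n 2≤n) (4≤b^[2+m] 2≤q (n ∸ 2)))

  -- Otherwise (p × 1)^{(1+m)n} = q^n × 1 = 0 would exhibit a zero divisor.
  p×1≈0 : p × 1# ≈ 0#
  p×1≈0 with (p × 1#) ≟ 0#
  ... | yes p×1≈0 = p×1≈0
  ... | no p×1≉0  = ⊥-elim (^-nonzero (suc m ℕ.* n) p×1≉0 (begin
    (p × 1#) ^ (suc m ℕ.* n)       ≈⟨ ^×1≈×1^ p (suc m ℕ.* n) ⟨
    (p ℕ.^ (suc m ℕ.* n)) × 1#     ≡⟨ ≡.cong (_× 1#) Q≡p^N ⟨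
    (q ℕ.^ n) × 1#                 ≈⟨ Q×x≈0 1# ⟩
    0#                             ∎))
    where
    Q≡p^N : q ℕ.^ n ≡ p ℕ.^ (suc m ℕ.* n)
    Q≡p^N = ≡.trans (≡.cong (ℕ._^ n) q≡p^[1+m]) (ℕₚ.^-*-assoc p (suc m) n)

  q×1≈0 : q × 1# ≈ 0#
  q×1≈0 = ∣⇒×≈0 p×1≈0 (divides (p ℕ.^ m) (≡.trans q≡p^[1+m] (ℕₚ.*-comm p (p ℕ.^ m)))) 1#

  q-additive : IsAdditive q
  q-additive = ≡.subst IsAdditive (≡.sym q≡p^[1+m]) (additive-^ {p} (prime-char⇒additive p-prime p×1≈0) (suc m))

  q≡1+[q∸1] : q ≡ suc (q ∸ 1)
  q≡1+[q∸1] = ≡.sym (ℕₚ.m+[n∸m]≡n (ℕₚ.<-trans (s≤s z≤n) 2≤q))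

  -1^q≈-1 : (- 1#) ^ q ≈ - 1#
  -1^q≈-1 = begin
    (- 1#) ^ q              ≡⟨ ≡.cong ((- 1#) ^_) q≡1+[q∸1] ⟩
    (- 1#) ^ suc (q ∸ 1)    ≈⟨ additive⇒-‿^ {q ∸ 1} (≡.subst IsAdditive q≡1+[q∸1] q-additive) 1# ⟩
    - (1# ^ suc (q ∸ 1))    ≈⟨ -‿cong (1^n≈1 (suc (q ∸ 1))) ⟩
    - 1#                    ∎

  odd⇒1≉-1 : Odd q → ¬ 1# ≈ - 1#
  odd⇒1≉-1 (a , q≡2a+1) 1≈-1 = 1≉0 (begin
    1#                         ≈⟨ +-identityˡ 1# ⟨
    0# + 1#                    ≈⟨ +-cong 2a×1≈0 (×-homo-1 1#) ⟨
    (2 ℕ.* a) × 1# + 1 × 1#    ≈⟨ ×-homo-+ 1# (2 ℕ.* a) 1 ⟨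
    (2 ℕ.* a ℕ.+ 1) × 1#       ≡⟨ ≡.cong (_× 1#) q≡2a+1 ⟨
    q × 1#                     ≈⟨ q×1≈0 ⟩
    0#                         ∎)
    where
    2×1≈0 : 2 × 1# ≈ 0#
    2×1≈0 = trans (+-congˡ (+-identityʳ 1#)) (trans (+-congˡ 1≈-1) (-‿inverseʳ 1#))
    2a×1≈0 : (2 ℕ.* a) × 1# ≈ 0#
    2a×1≈0 = ∣⇒×≈0 2×1≈0 (divides a (ℕₚ.*-comm 2 a)) 1#

  frob : ℕ → Carrier → Carrier
  frob j x = x ^ (q ℕ.^ j)

  frob-cong : ∀ j → Congruent₁ _≈_ (frob j)
  frob-cong j = ^-congˡ (q ℕ.^ j)

  frob-+ : ∀ j x y → frob j (x + y) ≈ frob j x + frob j y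
  frob-+ j = additive-^ {q} q-additive j

  frob-* : ∀ j x y → frob j (x * y) ≈ frob j x * frob j y
  frob-* j x y = ^-distrib-* x y (q ℕ.^ j)

  frob-^ : ∀ j x a → frob j (x ^ a) ≈ frob j x ^ a
  frob-^ j x a = ^-comm x a (q ℕ.^ j)

  frob-⁻¹ : ∀ j x → frob j (x ⁻¹) ≈ frob j x ⁻¹
  frob-⁻¹ j x = sym (⁻¹-^ x (q ℕ.^ j))

  frob-≡ : ∀ {i j} x → i ≡ j → frob i x ≈ frob j x
  frob-≡ x i≡j = ^-congʳ x (≡.cong (q ℕ.^_) i≡j)

  frob∘frob : ∀ i j x → frob j (frob i x) ≈ frob (i ℕ.+ j) x
  frob∘frob i j x = trans (^-assocʳ x (q ℕ.^ i) (q ℕ.^ j)) (^-congʳ x (≡.sym (ℕₚ.^-distribˡ-+-* q i j)))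

  frob-n : ∀ x → frob n x ≈ x
  frob-n = x^Q≈x

  frob-1 : ∀ x → frob 1 x ≈ x ^ q
  frob-1 x = ^-congʳ x (ℕₚ.*-identityʳ q)

  frob-^q : ∀ j x → frob j x ^ q ≈ frob (suc j) x
  frob-^q j x = trans (^-assocʳ x (q ℕ.^ j) q) (^-congʳ x (ℕₚ.*-comm (q ℕ.^ j) q))

  ^q-injective : ∀ {x y} → x ^ q ≈ y ^ q → x ≈ y
  ^q-injective {x} {y} x^q≈y^q =
    trans (sym (frob[n∸1]∘^q x)) (trans (frob-cong (n ∸ 1) x^q≈y^q) (frob[n∸1]∘^q y))
    where
    frob[n∸1]∘^q : ∀ x → frob (n ∸ 1) (x ^ q) ≈ x
    frob[n∸1]∘^q x = begin
      frob (n ∸ 1) (x ^ q)        ≈⟨ frob-cong (n ∸ 1) (frob-1 x) ⟨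
      frob (n ∸ 1) (frob 1 x)     ≈⟨ frob∘frob 1 (n ∸ 1) x ⟩
      frob (suc (n ∸ 1)) x        ≈⟨ frob-≡ x (ℕₚ.m+[n∸m]≡n (ℕₚ.<-trans (s≤s z≤n) 2≤n)) ⟩
      frob n x                    ≈⟨ frob-n x ⟩
      x                           ∎

  open Poly R q n using (fL; gL; AreInverse; L₁₂; L₃; norm4)

  module InverseCriterion (L : Carrier → Carrier) (L-cong : Congruent₁ _≈_ L) where

    -- f(g(x)) = x, rewritten in terms of z = 1/x and w = z^{q+1}.
    InverseCondition : Set (ℓ₁ ⊔ ℓ₂)
    InverseCondition = ∀ z → ¬ z ≈ 0# →
      let w = z ^ (q ℕ.+ 1) ; s = L w ^ q in L (s ⁻¹ ^ (q ℕ.+ 1) * w) * s ≈ 1#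

    fL-cong : Congruent₁ _≈_ (fL L)
    fL-cong x≈y = *-cong (L-cong (^-congˡ (q ℕ.+ 1) x≈y)) (⁻¹-cong x≈y)

    gL-cong : Congruent₁ _≈_ (gL L)
    gL-cong x≈y = *-cong (⁻¹-cong x≈y) (⁻¹-cong (^-congˡ q (L-cong (^-congˡ (q ℕ.+ 1) (⁻¹-cong x≈y)))))

    fL∘gL : InverseCondition → ∀ x → fL L (gL L x) ≈ x
    fL∘gL condition x = begin
      L ((z * s ⁻¹) ^ (q ℕ.+ 1)) * (z * s ⁻¹) ⁻¹
        ≈⟨ *-cong (L-cong (trans (^-distrib-* z (s ⁻¹) (q ℕ.+ 1)) (*-comm _ _))) (⁻¹-distrib-* z (s ⁻¹)) ⟩
      L (s ⁻¹ ^ (q ℕ.+ 1) * w) * (z ⁻¹ * s ⁻¹ ⁻¹)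
        ≈⟨ *-congˡ (*-cong (⁻¹-involutive 3≤Q x) (⁻¹-involutive 3≤Q s)) ⟩
      L (s ⁻¹ ^ (q ℕ.+ 1) * w) * (x * s)            ≈⟨ x∙yz≈y∙xz _ x s ⟩
      x * (L (s ⁻¹ ^ (q ℕ.+ 1) * w) * s)            ≈⟨ x*[condition]≈x (x ≟ 0#) ⟩
      x                                             ∎
      where
      z = x ⁻¹
      w = z ^ (q ℕ.+ 1)
      s = L w ^ q
      x*[condition]≈x : Dec (x ≈ 0#) → x * (L (s ⁻¹ ^ (q ℕ.+ 1) * w) * s) ≈ x
      x*[condition]≈x (yes x≈0) = trans (*-congʳ x≈0) (trans (zeroˡ _) (sym x≈0))
      x*[condition]≈x (no x≉0)  = trans (*-congˡ (condition z (⁻¹-nonzero x≉0))) (*-identityʳ x)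

    areInverse : InverseCondition → AreInverse (fL L) (gL L)
    areInverse condition =
      fL∘gL condition , rightInverse⇒leftInverse (fL L) (gL L) fL-cong gL-cong (fL∘gL condition)

  module Trace (k : ℕ) (1≤k : 1 ≤ k) (n≡k+k : n ≡ k ℕ.+ k) where

    T : Carrier → Carrier
    T u = u + frob k u

    T-cong : Congruent₁ _≈_ T
    T-cong u≈v = +-cong u≈v (frob-cong k u≈v)

    frob-T : ∀ u → frob k (T u) ≈ T u
    frob-T u = begin
      frob k (u + frob k u)          ≈⟨ frob-+ k u (frob k u) ⟩
      frob k u + frob k (frob k u)   ≈⟨ +-congˡ (frob∘frob k k u) ⟩
      frob k u + frob (k ℕ.+ k) u    ≈⟨ +-congˡ (trans (frob-≡ u (≡.sym n≡k+k)) (frob-n u)) ⟩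
      frob k u + u                   ≈⟨ +-comm _ _ ⟩
      T u                            ∎

    T-* : ∀ {c} u → frob k c ≈ c → T (c * u) ≈ c * T u
    T-* {c} u frob-c≈c = trans (+-congˡ (trans (frob-* k c u) (*-congʳ frob-c≈c))) (sym (distribˡ c u (frob k u)))

    L₁₂^q≈T : ∀ b y → L₁₂ k b y ^ q ≈ T (b * y)
    L₁₂^q≈T b y = begin
      (frob (n ∸ 1) v + frob (k ∸ 1) v) ^ q         ≈⟨ q-additive _ _ ⟩
      frob (n ∸ 1) v ^ q + frob (k ∸ 1) v ^ q       ≈⟨ +-cong (frob-^q (n ∸ 1) v) (frob-^q (k ∸ 1) v) ⟩
      frob (suc (n ∸ 1)) v + frob (suc (k ∸ 1)) v   ≈⟨ +-cong (trans (frob-≡ v (ℕₚ.m+[n∸m]≡n 1≤n)) (frob-n v))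
                                                              (frob-≡ v (ℕₚ.m+[n∸m]≡n 1≤k)) ⟩
      v + frob k v                                  ∎
      where
      v = b * y
      1≤n = ℕₚ.<-trans (s≤s z≤n) 2≤n

    T≈0⇒^[q^k∸1]≈-1 : ∀ {u} → ¬ u ≈ 0# → T u ≈ 0# → u ^ (q ℕ.^ k ∸ 1) ≈ - 1#
    T≈0⇒^[q^k∸1]≈-1 {u} u≉0 T[u]≈0 = *-cancelˡ u≉0 (begin
      u * u ^ (q ℕ.^ k ∸ 1)       ≡⟨ ≡.cong (u ^_) (ℕₚ.m+[n∸m]≡n 1≤q^k) ⟩
      frob k u                    ≈⟨ inverseʳ-unique u (frob k u) T[u]≈0 ⟩
      - u                         ≈⟨ -1*x≈-x u ⟨
      - 1# * u                    ≈⟨ *-comm _ _ ⟩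
      u * - 1#                    ∎)
      where
      1≤q^k : 1 ≤ q ℕ.^ k
      1≤q^k = ℕₚ.m^n>0 q {{ℕ.>-nonZero (ℕₚ.<-trans (s≤s z≤n) 2≤q)}} k

    oddK⇒T[b*z^[q+1]]≉0 : Odd k → ∀ {b} → ¬ b ≈ 0# → ¬ b ^ ((q ℕ.^ n ∸ 1) / suc q) ≈ - 1# →
                          ∀ z → ¬ z ≈ 0# → ¬ T (b * z ^ (q ℕ.+ 1)) ≈ 0#
    oddK⇒T[b*z^[q+1]]≉0 (j , refl) {b} b≉0 b^[[Q∸1]/[1+q]]≉-1 z z≉0 T[u]≈0 = b^[[Q∸1]/[1+q]]≉-1 (begin
      b ^ ((q ℕ.^ n ∸ 1) / suc q)     ≡⟨ ≡.cong (b ^_) (*≡⇒/≡ [1+q]*D≡Q∸1) ⟩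
      b ^ D                           ≈⟨ *-identityʳ _ ⟨
      b ^ D * 1#                      ≈⟨ *-congˡ (x^[Q∸1]≈1 z≉0) ⟨
      b ^ D * z ^ (q ℕ.^ n ∸ 1)       ≡⟨ ≡.cong (λ e → b ^ D * z ^ e) [q+1]*D≡Q∸1 ⟨
      b ^ D * z ^ ((q ℕ.+ 1) ℕ.* D)   ≈⟨ *-congˡ (^-assocʳ z (q ℕ.+ 1) D) ⟨
      b ^ D * (z ^ (q ℕ.+ 1)) ^ D     ≈⟨ ^-distrib-* b _ D ⟨
      u ^ D                           ≈⟨ ^-assocʳ u (q ℕ.^ k ∸ 1) E ⟨
      (u ^ (q ℕ.^ k ∸ 1)) ^ E         ≈⟨ ^-congˡ E (T≈0⇒^[q^k∸1]≈-1 u≉0 T[u]≈0) ⟩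
      (- 1#) ^ E                      ≈⟨ -1^[1+e]≈-1⇒-1^[1+e*s]≈-1 {q ∸ 1} -1^[1+[q∸1]]≈-1 S ⟩
      - 1#                            ∎)
      where
      u = b * z ^ (q ℕ.+ 1)
      u≉0 = *-nonzero b≉0 (^-nonzero (q ℕ.+ 1) z≉0)
      cofactor = [1+q]∣q^[k+k]∸1 q j (ℕₚ.<-trans (s≤s z≤n) 2≤q)
      S = proj₁ cofactor
      E = suc ((q ∸ 1) ℕ.* S)
      D = (q ℕ.^ k ∸ 1) ℕ.* E
      [1+q]*D≡Q∸1 : suc q ℕ.* D ≡ q ℕ.^ n ∸ 1
      [1+q]*D≡Q∸1 = ≡.trans (proj₂ cofactor) (≡.cong (λ e → q ℕ.^ e ∸ 1) (≡.sym n≡k+k))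
      [q+1]*D≡Q∸1 : (q ℕ.+ 1) ℕ.* D ≡ q ℕ.^ n ∸ 1
      [q+1]*D≡Q∸1 = ≡.trans (≡.cong (ℕ._* D) (ℕₚ.+-comm q 1)) [1+q]*D≡Q∸1
      -1^[1+[q∸1]]≈-1 : (- 1#) ^ suc (q ∸ 1) ≈ - 1#
      -1^[1+[q∸1]]≈-1 = trans (^-congʳ (- 1#) (≡.sym q≡1+[q∸1])) -1^q≈-1

    evenK⇒T[b*z^[q+1]]≉0 : Even k → Odd q → ∀ {b} → ¬ b ≈ 0# → IsSquare R b →
                           ∀ z → ¬ z ≈ 0# → ¬ T (b * z ^ (q ℕ.+ 1)) ≈ 0#
    evenK⇒T[b*z^[q+1]]≉0 (j , refl) (a , refl) {b} b≉0 (d , b≈d*d) z z≉0 T[u]≈0 = odd⇒1≉-1 (a , refl) (begin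
      1#                              ≈⟨ x^[Q∸1]≈1 v≉0 ⟨
      v ^ (q ℕ.^ n ∸ 1)               ≡⟨ ≡.cong (v ^_) Q∸1≡2D ⟩
      v ^ (2 ℕ.* D)                   ≈⟨ ^-assocʳ v 2 D ⟨
      (v ^ 2) ^ D                     ≈⟨ ^-congˡ D (trans (*-congˡ (*-identityʳ v)) (sym u≈v*v)) ⟩
      u ^ D                           ≈⟨ ^-assocʳ u (q ℕ.^ k ∸ 1) E ⟨
      (u ^ (q ℕ.^ k ∸ 1)) ^ E         ≈⟨ ^-congˡ E (T≈0⇒^[q^k∸1]≈-1 u≉0 T[u]≈0) ⟩
      (- 1#) ^ E                      ≈⟨ -1^[1+e]≈-1⇒-1^[1+e*s]≈-1 {2} -1^3≈-1 t ⟩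
      - 1#                            ∎)
      where
      u = b * z ^ (q ℕ.+ 1)
      u≉0 = *-nonzero b≉0 (^-nonzero (q ℕ.+ 1) z≉0)
      y = z ^ suc a
      v = d * y
      u≈v*v : u ≈ v * v
      u≈v*v = begin
        b * z ^ (q ℕ.+ 1)           ≡⟨ ≡.cong (λ e → b * z ^ e) (q+1≡[1+a]+[1+a] a) ⟩
        b * z ^ (suc a ℕ.+ suc a)   ≈⟨ *-cong b≈d*d (^-homo-* z (suc a) (suc a)) ⟩
        (d * d) * (y * y)           ≈⟨ interchange d d y y ⟩
        v * v                       ∎
        where
        q+1≡[1+a]+[1+a] : ∀ a → 2 ℕ.* a ℕ.+ 1 ℕ.+ 1 ≡ suc a ℕ.+ suc a
        q+1≡[1+a]+[1+a] = solve-∀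
      v≉0 : ¬ v ≈ 0#
      v≉0 v≈0 = u≉0 (trans u≈v*v (trans (*-congʳ v≈0) (zeroˡ v)))
      factorisation = q^[k+k]∸1≡2[q^k∸1][1+2c] a j
      t = proj₁ factorisation
      E = suc (2 ℕ.* t)
      D = (q ℕ.^ (2 ℕ.* j) ∸ 1) ℕ.* E
      Q∸1≡2D : q ℕ.^ n ∸ 1 ≡ 2 ℕ.* D
      Q∸1≡2D = ≡.trans (≡.cong (λ e → q ℕ.^ e ∸ 1) n≡k+k) (proj₂ factorisation)
      -1^3≈-1 : (- 1#) ^ 3 ≈ - 1#
      -1^3≈-1 = trans (*-congˡ (trans (*-congˡ (*-identityʳ _)) -1*-1≈1)) (*-identityʳ _)

    module TraceForm (b : Carrier) (L : Carrier → Carrier) (L≈L₁₂ : ∀ y → L y ≈ L₁₂ k b y)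
                     (T[b*z^[q+1]]≉0 : ∀ z → ¬ z ≈ 0# → ¬ T (b * z ^ (q ℕ.+ 1)) ≈ 0#) where

      L-cong : Congruent₁ _≈_ L
      L-cong {x} {y} x≈y = trans (L≈L₁₂ x) (trans L₁₂-cong (sym (L≈L₁₂ y)))
        where
        b*x≈b*y = *-congˡ x≈y
        L₁₂-cong = +-cong (frob-cong (n ∸ 1) b*x≈b*y) (frob-cong (k ∸ 1) b*x≈b*y)

      L^q≈T : ∀ y → L y ^ q ≈ T (b * y)
      L^q≈T y = trans (^-congˡ q (L≈L₁₂ y)) (L₁₂^q≈T b y)

      open InverseCriterion L L-cong using (InverseCondition)

      inverseCondition : InverseCondition
      inverseCondition z z≉0 = begin
        L (c * w) * s    ≈⟨ *-congʳ L[c*w]≈s⁻¹ ⟩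
        s ⁻¹ * s         ≈⟨ x⁻¹*x≈1 s≉0 ⟩
        1#               ∎
        where
        w = z ^ (q ℕ.+ 1)
        s = L w ^ q
        c = s ⁻¹ ^ (q ℕ.+ 1)
        s≉0 : ¬ s ≈ 0#
        s≉0 s≈0 = T[b*z^[q+1]]≉0 z z≉0 (trans (sym (L^q≈T w)) s≈0)
        frob-s : frob k s ≈ s
        frob-s = trans (frob-cong k (L^q≈T w)) (trans (frob-T _) (sym (L^q≈T w)))
        frob-c : frob k c ≈ c
        frob-c = trans (frob-^ k (s ⁻¹) (q ℕ.+ 1)) (^-congˡ (q ℕ.+ 1) (trans (frob-⁻¹ k s) (⁻¹-cong frob-s)))
        c*s≈s⁻¹^q : c * s ≈ s ⁻¹ ^ q
        c*s≈s⁻¹^q = begin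
          s ⁻¹ ^ (q ℕ.+ 1) * s           ≈⟨ *-congʳ (^-homo-* (s ⁻¹) q 1) ⟩
          (s ⁻¹ ^ q * (s ⁻¹ * 1#)) * s   ≈⟨ *-congʳ (*-congˡ (*-identityʳ _)) ⟩
          (s ⁻¹ ^ q * s ⁻¹) * s          ≈⟨ *-assoc _ _ _ ⟩
          s ⁻¹ ^ q * (s ⁻¹ * s)          ≈⟨ *-congˡ (x⁻¹*x≈1 s≉0) ⟩
          s ⁻¹ ^ q * 1#                  ≈⟨ *-identityʳ _ ⟩
          s ⁻¹ ^ q                       ∎
        L[c*w]≈s⁻¹ : L (c * w) ≈ s ⁻¹
        L[c*w]≈s⁻¹ = ^q-injective (begin
          L (c * w) ^ q      ≈⟨ L^q≈T (c * w) ⟩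
          T (b * (c * w))    ≈⟨ T-cong (x∙yz≈y∙xz b c w) ⟩
          T (c * (b * w))    ≈⟨ T-* (b * w) frob-c ⟩
          c * T (b * w)      ≈⟨ *-congˡ (L^q≈T w) ⟨
          c * s              ≈⟨ c*s≈s⁻¹^q ⟩
          s ⁻¹ ^ q           ∎)

      areInverse : AreInverse (fL L) (gL L)
      areInverse = InverseCriterion.areInverse L L-cong inverseCondition

  module Case3 (n≡2+2 : n ≡ 2 ℕ.+ 2) (odd-q : Odd q) (a b : Carrier) (b≉0 : ¬ b ≈ 0#) (b-square : IsSquare R b)
               (frob-r : frob 2 (a * (b ^ q) ⁻¹) ≈ a * (b ^ q) ⁻¹) (norm4a≉norm4b : ¬ norm4 a ≈ norm4 b)
               (L : Carrier → Carrier) (L≈L₃ : ∀ y → L y ≈ L₃ a b y) where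
    open Trace 2 (s≤s z≤n) n≡2+2

    M : Carrier → Carrier
    M y = a * y ^ q + b * y

    M-cong : Congruent₁ _≈_ M
    M-cong x≈y = +-cong (*-congˡ (^-congˡ q x≈y)) (*-congˡ x≈y)

    L≈T∘M : ∀ y → L y ≈ T (M y)
    L≈T∘M y = trans (L≈L₃ y) (begin
      frob 2 (a * y ^ q) + frob 2 (b * y) + a * y ^ q + b * y
        ≈⟨ solve 4 (λ A₂ B₂ A B → ((A₂ :+ B₂) :+ A) :+ B := (A :+ B) :+ (A₂ :+ B₂)) ≈-refl
                 (frob 2 (a * y ^ q)) (frob 2 (b * y)) (a * y ^ q) (b * y) ⟩
      M y + (frob 2 (a * y ^ q) + frob 2 (b * y))   ≈⟨ +-congˡ (frob-+ 2 _ _) ⟨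
      T (M y)                                       ∎)

    L-cong : Congruent₁ _≈_ L
    L-cong {x} {y} x≈y = trans (L≈T∘M x) (trans (T-cong (M-cong x≈y)) (sym (L≈T∘M y)))

    M-* : ∀ {c} y → c ^ q ≈ c → M (c * y) ≈ c * M y
    M-* {c} y c^q≈c = begin
      a * (c * y) ^ q + b * (c * y)    ≈⟨ +-congʳ (*-congˡ (trans (^-distrib-* c y q) (*-congʳ c^q≈c))) ⟩
      a * (c * y ^ q) + b * (c * y)    ≈⟨ +-cong (x∙yz≈y∙xz a c _) (x∙yz≈y∙xz b c y) ⟩
      c * (a * y ^ q) + c * (b * y)    ≈⟨ distribˡ c _ _ ⟨
      c * M y                          ∎

    ^q^q : ∀ x → (x ^ q) ^ q ≈ frob 2 x
    ^q^q x = trans (^-congˡ q (sym (frob-1 x))) (frob-^q 1 x)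

    r : Carrier
    r = a * (b ^ q) ⁻¹

    r*b^q≈a : r * b ^ q ≈ a
    r*b^q≈a = trans (*-assoc a _ _) (trans (*-congˡ (x⁻¹*x≈1 (^-nonzero q b≉0))) (*-identityʳ a))

    T∘M≈ : ∀ w → T (M w) ≈ T (b * w) + r * T (b * w) ^ q
    T∘M≈ w = begin
      T (M w)                                   ≈⟨ T-cong (+-congʳ M≈) ⟩
      T (r * v ^ q + v)                         ≈⟨ +-congˡ frob2[r*v^q+v] ⟩
      (r * v ^ q + v) + (r * frob 2 v ^ q + frob 2 v)
        ≈⟨ solve 5 (λ r vq v fq f → (r :* vq :+ v) :+ (r :* fq :+ f) := (v :+ f) :+ r :* (vq :+ fq)) ≈-refl
                 r (v ^ q) v (frob 2 v ^ q) (frob 2 v) ⟩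
      T v + r * (v ^ q + frob 2 v ^ q)          ≈⟨ +-congˡ (*-congˡ (q-additive v (frob 2 v))) ⟨
      T v + r * T v ^ q                         ∎
      where
      v = b * w
      M≈ : a * w ^ q ≈ r * v ^ q
      M≈ = trans (*-congʳ (sym r*b^q≈a)) (trans (*-assoc r _ _) (*-congˡ (sym (^-distrib-* b w q))))
      frob2[r*v^q+v] : frob 2 (r * v ^ q + v) ≈ r * frob 2 v ^ q + frob 2 v
      frob2[r*v^q+v] = trans (frob-+ 2 _ _) (+-congʳ (trans (frob-* 2 r (v ^ q)) (*-cong frob-r (frob-^ 2 v q))))

    -- Raise r t^q = -t to the power q + 1, using t^{q²} = t.
    r^[q+1]≈1 : ∀ {t} → ¬ t ≈ 0# → frob 2 t ≈ t → t + r * t ^ q ≈ 0# → r ^ (q ℕ.+ 1) ≈ 1#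
    r^[q+1]≈1 {t} t≉0 frob-t r*t^q≈-t = *-cancelʳ (*-nonzero t≉0 (^-nonzero q t≉0)) (begin
      r ^ (q ℕ.+ 1) * (t * t ^ q)                     ≈⟨ *-congˡ t*t^q≈ ⟩
      r ^ (q ℕ.+ 1) * (t ^ q) ^ (q ℕ.+ 1)             ≈⟨ ^-distrib-* r (t ^ q) (q ℕ.+ 1) ⟨
      (r * t ^ q) ^ (q ℕ.+ 1)                         ≈⟨ ^-congˡ (q ℕ.+ 1) r*t^q≈-1*t ⟩
      (- 1# * t) ^ (q ℕ.+ 1)                          ≈⟨ ^-distrib-* (- 1#) t (q ℕ.+ 1) ⟩
      (- 1#) ^ (q ℕ.+ 1) * t ^ (q ℕ.+ 1)              ≈⟨ *-cong (^-homo-* (- 1#) q 1) (^-homo-* t q 1) ⟩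
      ((- 1#) ^ q * (- 1# * 1#)) * (t ^ q * (t * 1#)) ≈⟨ *-cong (trans (*-cong -1^q≈-1 (*-identityʳ _)) -1*-1≈1)
                                                                 (trans (*-congˡ (*-identityʳ t)) (*-comm _ _)) ⟩
      1# * (t * t ^ q)                                ∎)
      where
      t*t^q≈ : t * t ^ q ≈ (t ^ q) ^ (q ℕ.+ 1)
      t*t^q≈ = sym (trans (^-homo-* (t ^ q) q 1) (*-cong (trans (^q^q t) frob-t) (*-identityʳ _)))
      r*t^q≈-1*t : r * t ^ q ≈ - 1# * t
      r*t^q≈-1*t = trans (inverseʳ-unique t _ r*t^q≈-t) (sym (-1*x≈-x t))

    r^[q+1]≈1⇒norm4a≈norm4b : r ^ (q ℕ.+ 1) ≈ 1# → norm4 a ≈ norm4 b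
    r^[q+1]≈1⇒norm4a≈norm4b r^[q+1]≈1 = begin
      a * a ^ q * frob 2 a * frob 3 a
        ≈⟨ *-cong (*-cong (*-cong (sym r*b^q≈a) a^q≈) frob2-a≈) frob3-a≈ ⟩
      r * β * (r ^ q * frob 2 b) * (r * frob 3 b) * (r ^ q * b)
        ≈⟨ solve 6 (λ r β r′ B₂ B₃ b → r :* β :* (r′ :* B₂) :* (r :* B₃) :* (r′ :* b)
                                       := ((r :* r′) :* (r :* r′)) :* (b :* β :* B₂ :* B₃))
                 ≈-refl r β (r ^ q) (frob 2 b) (frob 3 b) b ⟩
      ((r * r ^ q) * (r * r ^ q)) * norm4 b
        ≈⟨ *-congʳ (trans (*-cong r*r^q≈1 r*r^q≈1) (*-identityʳ 1#)) ⟩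
      1# * norm4 b                                     ≈⟨ *-identityˡ _ ⟩
      norm4 b                                          ∎
      where
      β = b ^ q
      r*r^q≈1 : r * r ^ q ≈ 1#
      r*r^q≈1 = trans (*-comm _ _) (trans (*-congˡ (sym (*-identityʳ r))) (trans (sym (^-homo-* r q 1)) r^[q+1]≈1))
      a^q≈ : a ^ q ≈ r ^ q * frob 2 b
      a^q≈ = trans (^-congˡ q (sym r*b^q≈a)) (trans (^-distrib-* r β q) (*-congˡ (^q^q b)))
      frob2-a≈ : frob 2 a ≈ r * frob 3 b
      frob2-a≈ = trans (frob-cong 2 (sym r*b^q≈a)) (trans (frob-* 2 r β)
                   (*-cong frob-r (trans (frob-cong 2 (sym (frob-1 b))) (frob∘frob 1 2 b))))
      frob3-a≈ : frob 3 a ≈ r ^ q * b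
      frob3-a≈ = trans (frob-cong 3 (sym r*b^q≈a)) (trans (frob-* 3 r β) (*-cong frob3-r frob3-β))
        where
        frob3-r : frob 3 r ≈ r ^ q
        frob3-r = trans (sym (frob∘frob 2 1 r)) (trans (frob-cong 1 frob-r) (frob-1 r))
        frob3-β : frob 3 β ≈ b
        frob3-β = trans (frob-cong 3 (sym (frob-1 b)))
                    (trans (frob∘frob 1 3 b) (trans (frob-≡ b (≡.sym n≡2+2)) (frob-n b)))

    T[M[z^[q+1]]]≉0 : ∀ z → ¬ z ≈ 0# → ¬ T (M (z ^ (q ℕ.+ 1))) ≈ 0#
    T[M[z^[q+1]]]≉0 z z≉0 T[M[w]]≈0 = norm4a≉norm4b (r^[q+1]≈1⇒norm4a≈norm4b
      (r^[q+1]≈1 (evenK⇒T[b*z^[q+1]]≉0 (1 , refl) odd-q b≉0 b-square z z≉0) (frob-T (b * w))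
                 (trans (sym (T∘M≈ w)) T[M[w]]≈0)))
      where w = z ^ (q ℕ.+ 1)

    open InverseCriterion L L-cong using (InverseCondition)

    -- Here c = (1/s)^{q+1} = 1/(L w · s) lies in 𝔽_q, so L(c w) = c L(w).
    inverseCondition : InverseCondition
    inverseCondition z z≉0 = begin
      L (c * w) * s                  ≈⟨ *-congʳ L[c*w]≈c*l ⟩
      (c * l) * s                    ≈⟨ *-congʳ (*-congʳ c≈l⁻¹*s⁻¹) ⟩
      ((l ⁻¹ * s ⁻¹) * l) * s        ≈⟨ *-congʳ (xy∙z≈xz∙y _ _ _) ⟩
      ((l ⁻¹ * l) * s ⁻¹) * s        ≈⟨ *-assoc _ _ _ ⟩
      (l ⁻¹ * l) * (s ⁻¹ * s)        ≈⟨ *-cong (x⁻¹*x≈1 l≉0) (x⁻¹*x≈1 s≉0) ⟩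
      1# * 1#                        ≈⟨ *-identityʳ 1# ⟩
      1#                             ∎
      where
      w = z ^ (q ℕ.+ 1)
      l = L w
      s = l ^ q
      c = s ⁻¹ ^ (q ℕ.+ 1)
      l≉0 : ¬ l ≈ 0#
      l≉0 l≈0 = T[M[z^[q+1]]]≉0 z z≉0 (trans (sym (L≈T∘M w)) l≈0)
      s≉0 : ¬ s ≈ 0#
      s≉0 = ^-nonzero q l≉0
      frob-l : frob 2 l ≈ l
      frob-l = trans (frob-cong 2 (L≈T∘M w)) (trans (frob-T _) (sym (L≈T∘M w)))
      s⁻¹^q≈l⁻¹ : s ⁻¹ ^ q ≈ l ⁻¹
      s⁻¹^q≈l⁻¹ = trans (sym (frob-1 (s ⁻¹)))
                    (trans (frob-⁻¹ 1 s) (⁻¹-cong (trans (frob-1 s) (trans (^q^q l) frob-l))))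
      l⁻¹^q≈s⁻¹ : l ⁻¹ ^ q ≈ s ⁻¹
      l⁻¹^q≈s⁻¹ = trans (sym (frob-1 (l ⁻¹))) (trans (frob-⁻¹ 1 l) (⁻¹-cong (frob-1 l)))
      c≈l⁻¹*s⁻¹ : c ≈ l ⁻¹ * s ⁻¹
      c≈l⁻¹*s⁻¹ = trans (^-homo-* (s ⁻¹) q 1) (*-cong s⁻¹^q≈l⁻¹ (*-identityʳ _))
      c^q≈c : c ^ q ≈ c
      c^q≈c = trans (^-congˡ q c≈l⁻¹*s⁻¹) (trans (^-distrib-* _ _ q)
                (trans (*-cong l⁻¹^q≈s⁻¹ s⁻¹^q≈l⁻¹) (trans (*-comm _ _) (sym c≈l⁻¹*s⁻¹))))
      frob2-c : frob 2 c ≈ c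
      frob2-c = trans (sym (^q^q c)) (trans (^-congˡ q c^q≈c) c^q≈c)
      L[c*w]≈c*l : L (c * w) ≈ c * l
      L[c*w]≈c*l = begin
        L (c * w)        ≈⟨ L≈T∘M _ ⟩
        T (M (c * w))    ≈⟨ T-cong (M-* w c^q≈c) ⟩
        T (c * M w)      ≈⟨ T-* (M w) frob2-c ⟩
        c * T (M w)      ≈⟨ *-congˡ (L≈T∘M w) ⟨
        c * l            ∎

    areInverse : AreInverse (fL L) (gL L)
    areInverse = InverseCriterion.areInverse L L-cong inverseCondition

mainTheorem6 : ∀ {c ℓ} (R : CommutativeRing c ℓ) (q n k : ℕ)
    → IsPrimePower q → IsField R → HasOrder R (q ℕ.^ n)
    → n ≡ 2 ℕ.* k
    → (L : CommutativeRing.Carrier R → CommutativeRing.Carrier R)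
    → Poly.Case1 R q n k L ⊎ Poly.Case2 R q n k L ⊎ Poly.Case3 R q n L
    → Poly.AreInverse R q n (Poly.fL R q n L) (Poly.gL R q n L)
mainTheorem6 R q n zero q-pp isField order refl L _ with FiniteField.2≤Q R isField (q ℕ.^ n) order
... | s≤s ()
mainTheorem6 R q n k@(suc _) q-pp isField order n≡2k L = inverse
  where
  open PrimePowerField R isField q-pp order (≡.subst (2 ≤_) (≡.sym n≡2k) (ℕₚ.m≤m*n 2 k))
  open Trace k (s≤s z≤n) (≡.trans n≡2k (≡.cong (k ℕ.+_) (ℕₚ.+-identityʳ k)))

  inverse : Poly.Case1 R q n k L ⊎ Poly.Case2 R q n k L ⊎ Poly.Case3 R q n L
          → Poly.AreInverse R q n (Poly.fL R q n L) (Poly.gL R q n L)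
  inverse (inj₁ (odd-k , b , b≉0 , b^[[Q∸1]/[1+q]]≉-1 , L≈L₁₂)) =
    TraceForm.areInverse b L L≈L₁₂ (oddK⇒T[b*z^[q+1]]≉0 odd-k b≉0 b^[[Q∸1]/[1+q]]≉-1)
  inverse (inj₂ (inj₁ (even-k , odd-q , b , b≉0 , b-square , L≈L₁₂))) =
    TraceForm.areInverse b L L≈L₁₂ (evenK⇒T[b*z^[q+1]]≉0 even-k odd-q b≉0 b-square)
  inverse (inj₂ (inj₂ (n≡4 , odd-q , a , b , _ , b≉0 , _ , b-square , frob-r , norm4a≉norm4b , L≈L₃))) =
    Case3.areInverse n≡4 odd-q a b b≉0 b-square frob-r norm4a≉norm4b L L≈L₃
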